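{- Let $i,j,k,s$ be positive integers and let $P=\mathrm{Cay}^s_\Sigma([0,i],[0,j],[0,k])=\mathrm{conv}\big([0,i]\times\{(0,0)\}\cup[0,j]\times\{(s,0)\}\cup[0,k]\times\{(0,s)\}\big)\subset\mathbb{R}^3$, and suppose $|P\cap\mathbb{Z}^3|\le 16$. Then $s\le 2$ and $i+j+k\le 13$. Moreover, if $i\ge j\ge k$ then $k\le 4$.
   Context: $\Sigma$ denotes the inner normal fan of a line segment (the fan of $\mathbb{P}^1$). -}

module Defs where

open import Data.Nat as ℕ using (ℕ)
open import Data.Integer as ℤ using (ℤ; +_)
open import Data.Rational as ℚ using (ℚ; 0ℚ; 1ℚ)
open import Data.Fin using (Fin; zero; suc)
open import Data.Product using (_×_; _,_; Σ; ∃)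
open import Data.List using (List; length)
open import Data.List.Membership.Propositional using (_∈_)
open import Relation.Binary.PropositionalEquality using (_≡_)

ℤ³ : Set
ℤ³ = ℤ × ℤ × ℤ

ℚ³ : Set
ℚ³ = ℚ × ℚ × ℚ

ℕ→ℚ : ℕ → ℚ
ℕ→ℚ n = (+ n) ℚ./ 1

ℤ→ℚ : ℤ → ℚ
ℤ→ℚ z = z ℚ./ 1

∑ : (n : ℕ) → (Fin n → ℚ) → ℚ
∑ ℕ.zero f = 0ℚ
∑ (ℕ.suc n) f = f zero ℚ.+ ∑ n (λ a → f (suc a))

InConv : (n : ℕ) → (Fin n → ℚ³) → ℚ³ → Set
InConv n v (x , y , z) =
  Σ (Fin n → ℚ) λ c →
    ((a : Fin n) → 0ℚ ℚ.≤ c a) ×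
    (∑ n c ≡ 1ℚ) ×
    (∑ n (λ a → c a ℚ.* Data.Product.proj₁ (v a)) ≡ x) ×
    (∑ n (λ a → c a ℚ.* Data.Product.proj₁ (Data.Product.proj₂ (v a))) ≡ y) ×
    (∑ n (λ a → c a ℚ.* Data.Product.proj₂ (Data.Product.proj₂ (v a))) ≡ z)

-- Cay^s_Σ([0,i],[0,j],[0,k]) = conv([0,i]×{(0,0)} ∪ [0,j]×{(s,0)} ∪ [0,k]×{(0,s)}),
-- which is the convex hull of the endpoints of the three segments.
cayVertices : (i j k s : ℕ) → Fin 6 → ℚ³
cayVertices i j k s zero = (0ℚ , 0ℚ , 0ℚ)
cayVertices i j k s (suc zero) = (ℕ→ℚ i , 0ℚ , 0ℚ)
cayVertices i j k s (suc (suc zero)) = (0ℚ , ℕ→ℚ s , 0ℚ)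
cayVertices i j k s (suc (suc (suc zero))) = (ℕ→ℚ j , ℕ→ℚ s , 0ℚ)
cayVertices i j k s (suc (suc (suc (suc zero)))) = (0ℚ , 0ℚ , ℕ→ℚ s)
cayVertices i j k s (suc (suc (suc (suc (suc zero))))) = (ℕ→ℚ k , 0ℚ , ℕ→ℚ s)

InCay : (i j k s : ℕ) → ℤ³ → Set
InCay i j k s (a , b , c) = InConv 6 (cayVertices i j k s) (ℤ→ℚ a , ℤ→ℚ b , ℤ→ℚ c)

LatticeCountAtMost : (ℤ³ → Set) → ℕ → Set
LatticeCountAtMost P N = ∃ λ (L : List ℤ³) → (length L ℕ.≤ N) × ((p : ℤ³) → P p → p ∈ L)

module Submission where

-- Both bounds come
-- from exhibiting many distinct lattice points of P:
--   * the three segments alone carry (i+1)+(j+1)+(k+1) lattice points, so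
--     i+j+k+3 ≤ 16, i.e. i+j+k ≤ 13; if moreover i ≥ j ≥ k then 3k ≤ 13;
--   * if s ≥ 3, then for a ∈ {0,1} the triangle with vertices (a,0,0),
--     (a,3,0), (a,0,3) lies in P, and its boundary carries 9 lattice points,
--     giving 18 > 16 points; hence s ≤ 2.
-- The file first develops the general facts these arguments rest on: the
-- rationals r/(m+1) and linear interpolation between two rationals, finite
-- sums, convexity of a rational convex hull (so it contains the lattice points
-- of any segment between its points), and the count bound "an injective
-- family of m lattice points of Q forces m ≤ N".

open import Defs
open import Data.Nat using (ℕ; _≤_; _+_)
open import Data.Product using (_×_)

open import Data.Nat as ℕ using (suc; zero; s≤s; z≤n)
import Data.Nat.Properties as ℕP
import Data.Nat.Coprimality as Coprimality
open import Data.Integer as ℤ using (ℤ; +_)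
import Data.Integer.Properties as ℤP
open import Data.Rational as ℚ using (ℚ; 0ℚ; 1ℚ; mkℚ; 1/_)
import Data.Rational.Properties as ℚP
open import Data.Nat.Tactic.RingSolver using (solve-∀)
open import Data.Rational.Solver using (module +-*-Solver)
open import Data.Fin as Fin using (Fin; toℕ)
import Data.Fin.Properties as FinP
open import Data.Product using (_,_; proj₁; proj₂)
open import Data.Product.Properties using (≡-dec)
open import Data.Sum using (_⊎_; inj₁; inj₂)
open import Data.List using (length; lookup)
open import Data.List.Relation.Unary.Any using (index)
open import Data.List.Relation.Unary.Any.Properties using (lookup-index)
open import Data.Vec as Vec using (Vec; []; _∷_; _++_)
open import Data.Vec.Relation.Unary.All using (All; _∷_; [])
open import Data.Vec.Relation.Unary.All.Properties using (lookup⁺; ++⁺)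
open import Data.Empty using (⊥-elim)
open import Function using (_∘_)
open import Function.Bundles using (_↔_; _↣_; Injection)
open import Function.Definitions using (Injective)
open import Function.Properties.Inverse using (↔-trans; ↔-refl; ↔⇒↣)
open import Data.Sum.Function.Propositional using (_⊎-↔_)
open import Relation.Nullary using (Dec; yes; no; _→-dec_)
open import Relation.Nullary.Decidable using (from-yes; from-no)
open import Relation.Binary.PropositionalEquality
open ≡-Reasoning

open +-*-Solver

ℕ→ℚ-mkℚ : ∀ n → ℕ→ℚ n ≡ mkℚ (+ n) 0 (Coprimality.sym (Coprimality.1-coprimeTo n))
ℕ→ℚ-mkℚ n = ℚP.normalize-coprime (Coprimality.sym (Coprimality.1-coprimeTo n))

ℕ→ℚ-mono-≤ : ∀ {m n} → m ℕ.≤ n → ℕ→ℚ m ℚ.≤ ℕ→ℚ n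
ℕ→ℚ-mono-≤ {m} {n} m≤n rewrite ℕ→ℚ-mkℚ m | ℕ→ℚ-mkℚ n =
  ℚ.*≤* (subst₂ ℤ._≤_ (sym (ℤP.*-identityʳ (+ m))) (sym (ℤP.*-identityʳ (+ n))) (ℤ.+≤+ m≤n))

ℕ→ℚ-nonNeg : ∀ n → ℚ.NonNegative (ℕ→ℚ n)
ℕ→ℚ-nonNeg n = ℚP.normalize-nonNeg n 1

ℕ→ℚ-suc-pos : ∀ m → ℚ.Positive (ℕ→ℚ (suc m))
ℕ→ℚ-suc-pos m = ℚP.normalize-pos (suc m) 1

ℕ→ℚ-suc-nonZero : ∀ m → ℚ.NonZero (ℕ→ℚ (suc m))
ℕ→ℚ-suc-nonZero m = ℚP.pos⇒nonZero (ℕ→ℚ (suc m)) {{ℕ→ℚ-suc-pos m}}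

inverse : ℕ → ℚ
inverse m = (1/ ℕ→ℚ (suc m)) {{ℕ→ℚ-suc-nonZero m}}

ratio : ℕ → ℕ → ℚ
ratio r m = ℕ→ℚ r ℚ.* inverse m

inverse-nonNeg : ∀ m → ℚ.NonNegative (inverse m)
inverse-nonNeg m = ℚP.pos⇒nonNeg (inverse m)
  {{ℚP.1/pos⇒pos (ℕ→ℚ (suc m)) {{ℕ→ℚ-suc-pos m}}}}

ratio-nonNeg : ∀ r m → 0ℚ ℚ.≤ ratio r m
ratio-nonNeg r m = ℚP.nonNegative⁻¹ (ratio r m)
  {{ℚP.nonNeg*nonNeg⇒nonNeg (ℕ→ℚ r) {{ℕ→ℚ-nonNeg r}} (inverse m) {{inverse-nonNeg m}}}}

ratio-≤1 : ∀ r m → r ℕ.≤ suc m → ratio r m ℚ.≤ 1ℚ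
ratio-≤1 r m r≤m+1 =
  subst (ratio r m ℚ.≤_) (ℚP.*-inverseʳ (ℕ→ℚ (suc m)) {{ℕ→ℚ-suc-nonZero m}})
    (ℚP.*-monoʳ-≤-nonNeg (inverse m) {{inverse-nonNeg m}} (ℕ→ℚ-mono-≤ r≤m+1))

ratio-scale : ∀ r m → ratio r m ℚ.* ℕ→ℚ (suc m) ≡ ℕ→ℚ r
ratio-scale r m = begin
  ℕ→ℚ r ℚ.* inverse m ℚ.* ℕ→ℚ (suc m)   ≡⟨ ℚP.*-assoc (ℕ→ℚ r) (inverse m) (ℕ→ℚ (suc m)) ⟩
  ℕ→ℚ r ℚ.* (inverse m ℚ.* ℕ→ℚ (suc m)) ≡⟨ cong (ℕ→ℚ r ℚ.*_) (ℚP.*-inverseˡ (ℕ→ℚ (suc m)) {{ℕ→ℚ-suc-nonZero m}}) ⟩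
  ℕ→ℚ r ℚ.* 1ℚ                           ≡⟨ ℚP.*-identityʳ (ℕ→ℚ r) ⟩
  ℕ→ℚ r                                  ∎

lerp : ℚ → ℚ → ℚ → ℚ
lerp t a b = (1ℚ ℚ.- t) ℚ.* a ℚ.+ t ℚ.* b

lerp-same : ∀ t a → lerp t a a ≡ a
lerp-same = solve 2 (λ t a → (con 1ℚ :- t) :* a :+ t :* a := a) refl

lerp-+ : ∀ t a b c d → lerp t a b ℚ.+ lerp t c d ≡ lerp t (a ℚ.+ c) (b ℚ.+ d)
lerp-+ = solve 5 (λ t a b c d →
  ((con 1ℚ :- t) :* a :+ t :* b) :+ ((con 1ℚ :- t) :* c :+ t :* d)
    := (con 1ℚ :- t) :* (a :+ c) :+ t :* (b :+ d)) refl

lerp-* : ∀ t a b w → lerp t a b ℚ.* w ≡ lerp t (a ℚ.* w) (b ℚ.* w)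
lerp-* = solve 4 (λ t a b w →
  ((con 1ℚ :- t) :* a :+ t :* b) :* w := (con 1ℚ :- t) :* (a :* w) :+ t :* (b :* w)) refl

lerp-ratio : ∀ r m → lerp (ratio r m) 0ℚ (ℕ→ℚ (suc m)) ≡ ℕ→ℚ r
lerp-ratio r m = trans
  (solve 2 (λ t a → (con 1ℚ :- t) :* con 0ℚ :+ t :* a := t :* a) refl (ratio r m) (ℕ→ℚ (suc m)))
  (ratio-scale r m)

lerp-nonNeg : ∀ {t a b} → 0ℚ ℚ.≤ t → t ℚ.≤ 1ℚ → 0ℚ ℚ.≤ a → 0ℚ ℚ.≤ b → 0ℚ ℚ.≤ lerp t a b
lerp-nonNeg {t} {a} {b} 0≤t t≤1 0≤a 0≤b =
  ℚP.+-mono-≤ {0ℚ} {_} {0ℚ} (product-nonNeg 0≤1-t 0≤a) (product-nonNeg 0≤t 0≤b)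
  where
  product-nonNeg : ∀ {p q} → 0ℚ ℚ.≤ p → 0ℚ ℚ.≤ q → 0ℚ ℚ.≤ p ℚ.* q
  product-nonNeg {p} {q} 0≤p 0≤q = ℚP.nonNegative⁻¹ (p ℚ.* q)
    {{ℚP.nonNeg*nonNeg⇒nonNeg p {{ℚ.nonNegative 0≤p}} q {{ℚ.nonNegative 0≤q}}}}
  0≤1-t : 0ℚ ℚ.≤ 1ℚ ℚ.- t
  0≤1-t = subst (ℚ._≤ 1ℚ ℚ.- t) (ℚP.+-inverseʳ t) (ℚP.+-monoˡ-≤ (ℚ.- t) t≤1)

∑-cong : ∀ n {f g : Fin n → ℚ} → (∀ a → f a ≡ g a) → ∑ n f ≡ ∑ n g
∑-cong zero    f≡g = refl
∑-cong (suc n) f≡g = cong₂ ℚ._+_ (f≡g Fin.zero) (∑-cong n (f≡g ∘ Fin.suc))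

∑-lerp : ∀ n t (f g : Fin n → ℚ) → ∑ n (λ a → lerp t (f a) (g a)) ≡ lerp t (∑ n f) (∑ n g)
∑-lerp zero    t f g = sym (lerp-same t 0ℚ)
∑-lerp (suc n) t f g = begin
  lerp t (f Fin.zero) (g Fin.zero) ℚ.+ ∑ n (λ a → lerp t (f (Fin.suc a)) (g (Fin.suc a)))
    ≡⟨ cong (lerp t (f Fin.zero) (g Fin.zero) ℚ.+_) (∑-lerp n t (f ∘ Fin.suc) (g ∘ Fin.suc)) ⟩
  lerp t (f Fin.zero) (g Fin.zero) ℚ.+ lerp t (∑ n (f ∘ Fin.suc)) (∑ n (g ∘ Fin.suc))
    ≡⟨ lerp-+ t _ _ _ _ ⟩
  lerp t (∑ (suc n) f) (∑ (suc n) g) ∎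

∑-0* : ∀ n (f : Fin n → ℚ) → ∑ n (λ a → 0ℚ ℚ.* f a) ≡ 0ℚ
∑-0* zero    f = refl
∑-0* (suc n) f = cong₂ ℚ._+_ (ℚP.*-zeroˡ (f Fin.zero)) (∑-0* n (f ∘ Fin.suc))

δ : ∀ {n} → Fin n → Fin n → ℚ
δ Fin.zero    Fin.zero    = 1ℚ
δ Fin.zero    (Fin.suc a) = 0ℚ
δ (Fin.suc b) Fin.zero    = 0ℚ
δ (Fin.suc b) (Fin.suc a) = δ b a

δ-nonNeg : ∀ {n} (b a : Fin n) → 0ℚ ℚ.≤ δ b a
δ-nonNeg Fin.zero    Fin.zero    = ℚ.*≤* (ℤ.+≤+ z≤n)
δ-nonNeg Fin.zero    (Fin.suc a) = ℚP.≤-refl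
δ-nonNeg (Fin.suc b) Fin.zero    = ℚP.≤-refl
δ-nonNeg (Fin.suc b) (Fin.suc a) = δ-nonNeg b a

∑-δ : ∀ n (b : Fin n) (f : Fin n → ℚ) → ∑ n (λ a → δ b a ℚ.* f a) ≡ f b
∑-δ (suc n) Fin.zero f =
  trans (cong₂ ℚ._+_ (ℚP.*-identityˡ (f Fin.zero)) (∑-0* n (f ∘ Fin.suc)))
        (ℚP.+-identityʳ (f Fin.zero))
∑-δ (suc n) (Fin.suc b) f =
  trans (cong₂ ℚ._+_ (ℚP.*-zeroˡ (f Fin.zero)) (∑-δ n b (f ∘ Fin.suc)))
        (ℚP.+-identityˡ (f (Fin.suc b)))

mix : ℚ → ℚ³ → ℚ³ → ℚ³
mix t (x , y , z) (x′ , y′ , z′) = lerp t x x′ , lerp t y y′ , lerp t z z′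

triangleBoundary : ℕ → Vec ℤ³ 9
triangleBoundary a =
  (+ a , + 0 , + 0) ∷ (+ a , + 1 , + 0) ∷ (+ a , + 2 , + 0) ∷ (+ a , + 3 , + 0) ∷
  (+ a , + 0 , + 1) ∷ (+ a , + 0 , + 2) ∷ (+ a , + 0 , + 3) ∷
  (+ a , + 2 , + 1) ∷ (+ a , + 1 , + 2) ∷ []

module ConvexHull {n : ℕ} (v : Fin n → ℚ³) where

  Hull : ℚ³ → Set
  Hull = InConv n v

  LatticeHull : ℤ³ → Set
  LatticeHull (a , b , c) = Hull (ℤ→ℚ a , ℤ→ℚ b , ℤ→ℚ c)

  vertex : ∀ b → Hull (v b)
  vertex b = δ b , δ-nonNeg b
    , trans (∑-cong n (λ a → sym (ℚP.*-identityʳ (δ b a)))) (∑-δ n b (λ _ → 1ℚ))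
    , ∑-δ n b _ , ∑-δ n b _ , ∑-δ n b _

  -- The hull is convex: interpolate the two coefficient vectors.
  convex : ∀ t p q → 0ℚ ℚ.≤ t → t ℚ.≤ 1ℚ → Hull p → Hull q → Hull (mix t p q)
  convex t (x , y , z) (x′ , y′ , z′) 0≤t t≤1 (c , c≥0 , ∑c , cx , cy , cz) (d , d≥0 , ∑d , dx , dy , dz) =
    e , (λ a → lerp-nonNeg 0≤t t≤1 (c≥0 a) (d≥0 a))
      , trans (∑-lerp n t c d) (trans (cong₂ (lerp t) ∑c ∑d) (lerp-same t 1ℚ))
      , coordinate proj₁ cx dx
      , coordinate (proj₁ ∘ proj₂) cy dy
      , coordinate (proj₂ ∘ proj₂) cz dz
    where
    e : Fin n → ℚ
    e a = lerp t (c a) (d a)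
    coordinate : (π : ℚ³ → ℚ) {w w′ : ℚ} →
      ∑ n (λ a → c a ℚ.* π (v a)) ≡ w → ∑ n (λ a → d a ℚ.* π (v a)) ≡ w′ →
      ∑ n (λ a → e a ℚ.* π (v a)) ≡ lerp t w w′
    coordinate π cw dw = begin
      ∑ n (λ a → e a ℚ.* π (v a))
        ≡⟨ ∑-cong n (λ a → lerp-* t (c a) (d a) (π (v a))) ⟩
      ∑ n (λ a → lerp t (c a ℚ.* π (v a)) (d a ℚ.* π (v a)))
        ≡⟨ ∑-lerp n t _ _ ⟩
      lerp t (∑ n (λ a → c a ℚ.* π (v a))) (∑ n (λ a → d a ℚ.* π (v a)))
        ≡⟨ cong₂ (lerp t) cw dw ⟩
      lerp t _ _ ∎

  between : ∀ m r {p q w} → r ℕ.≤ suc m → Hull p → Hull q → mix (ratio r m) p q ≡ w → Hull w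
  between m r r≤m+1 hp hq refl =
    convex (ratio r m) _ _ (ratio-nonNeg r m) (ratio-≤1 r m r≤m+1) hp hq

  along-x : ∀ m r {y z} → r ℕ.≤ suc m →
    Hull (0ℚ , y , z) → Hull (ℕ→ℚ (suc m) , y , z) → Hull (ℕ→ℚ r , y , z)
  along-x m r {y} {z} r≤ h₀ h₁ =
    between m r r≤ h₀ h₁ (cong₂ _,_ (lerp-ratio r m) (cong₂ _,_ (lerp-same (ratio r m) y) (lerp-same (ratio r m) z)))

  along-y : ∀ m r {x z} → r ℕ.≤ suc m →
    Hull (x , 0ℚ , z) → Hull (x , ℕ→ℚ (suc m) , z) → Hull (x , ℕ→ℚ r , z)
  along-y m r {x} {z} r≤ h₀ h₁ =
    between m r r≤ h₀ h₁ (cong₂ _,_ (lerp-same (ratio r m) x) (cong₂ _,_ (lerp-ratio r m) (lerp-same (ratio r m) z)))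

  along-z : ∀ m r {x y} → r ℕ.≤ suc m →
    Hull (x , y , 0ℚ) → Hull (x , y , ℕ→ℚ (suc m)) → Hull (x , y , ℕ→ℚ r)
  along-z m r {x} {y} r≤ h₀ h₁ =
    between m r r≤ h₀ h₁ (cong₂ _,_ (lerp-same (ratio r m) x) (cong₂ _,_ (lerp-same (ratio r m) y) (lerp-ratio r m)))

  -- If the hull contains (a,0,0), (a,h,0) and (a,0,h) with h ≥ 3, it contains
  -- the boundary lattice points of the triangle (a,0,0), (a,3,0), (a,0,3):
  -- those on the legs by along-y/along-z, the two on the hypotenuse as
  -- interpolations of (a,3,0) and (a,0,3) at parameters 1/3 and 2/3.
  triangle : ∀ a m → 3 ℕ.≤ suc m → Hull (ℕ→ℚ a , 0ℚ , 0ℚ) →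
    Hull (ℕ→ℚ a , ℕ→ℚ (suc m) , 0ℚ) → Hull (ℕ→ℚ a , 0ℚ , ℕ→ℚ (suc m)) →
    All LatticeHull (triangleBoundary a)
  triangle a m 3≤h base top side =
    base ∷ leg-y 1 1≤3 ∷ leg-y 2 2≤3 ∷ leg-y 3 ℕP.≤-refl ∷
    leg-z 1 1≤3 ∷ leg-z 2 2≤3 ∷ leg-z 3 ℕP.≤-refl ∷
    hypotenuse 1 1≤3 refl ∷ hypotenuse 2 2≤3 refl ∷ []
    where
    1≤3 : 1 ℕ.≤ 3
    1≤3 = s≤s z≤n
    2≤3 : 2 ℕ.≤ 3
    2≤3 = s≤s (s≤s z≤n)
    leg-y : ∀ b → b ℕ.≤ 3 → Hull (ℕ→ℚ a , ℕ→ℚ b , 0ℚ)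
    leg-y b b≤3 = along-y m b (ℕP.≤-trans b≤3 3≤h) base top
    leg-z : ∀ c → c ℕ.≤ 3 → Hull (ℕ→ℚ a , 0ℚ , ℕ→ℚ c)
    leg-z c c≤3 = along-z m c (ℕP.≤-trans c≤3 3≤h) base side
    -- Interpolation between (a,3,0) and (a,0,3) at parameter r/3; for the
    -- numerals r = 1, 2 the last two coordinates evaluate by computation.
    hypotenuse : ∀ r {y z} → r ℕ.≤ 3 →
      (lerp (ratio r 2) (ℕ→ℚ 3) 0ℚ , lerp (ratio r 2) 0ℚ (ℕ→ℚ 3)) ≡ (y , z) →
      Hull (ℕ→ℚ a , y , z)
    hypotenuse r r≤3 yz = between 2 r r≤3 (leg-y 3 ℕP.≤-refl) (leg-z 3 ℕP.≤-refl)
      (cong₂ _,_ (lerp-same (ratio r 2) (ℕ→ℚ a)) yz)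

-- An injective family of m lattice points of Q forces m ≤ N whenever Q has
-- at most N lattice points: sending each point to its position in the
-- covering list is injective, so m ≤ length of the list.
count : ∀ {Q : ℤ³ → Set} {N m} (g : Fin m → ℤ³) → Injective _≡_ _≡_ g →
  (∀ a → Q (g a)) → LatticeCountAtMost Q N → m ℕ.≤ N
count {Q} {N} {m} g g-injective g∈Q (L , |L|≤N , covers) =
  ℕP.≤-trans (FinP.injective⇒≤ position-injective) |L|≤N
  where
  position : Fin m → Fin (length L)
  position a = index (covers (g a) (g∈Q a))
  position-injective : Injective _≡_ _≡_ position
  position-injective {a} {b} same = g-injective (begin
    g a                 ≡⟨ lookup-index (covers (g a) (g∈Q a)) ⟩
    lookup L (position a) ≡⟨ cong (lookup L) same ⟩
    lookup L (position b) ≡⟨ lookup-index (covers (g b) (g∈Q b)) ⟨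
    g b                 ∎)

injective? : ∀ {m} (g : Fin m → ℤ³) → Dec (∀ a b → g a ≡ g b → a ≡ b)
injective? g = FinP.all? λ a → FinP.all? λ b → ≡-dec ℤ._≟_ (≡-dec ℤ._≟_ ℤ._≟_) (g a) (g b) →-dec (a FinP.≟ b)

segmentPoint : ∀ i j k s → Fin (suc i) ⊎ (Fin (suc j) ⊎ Fin (suc k)) → ℤ³
segmentPoint i j k s (inj₁ a)        = + toℕ a , + 0 , + 0
segmentPoint i j k s (inj₂ (inj₁ a)) = + toℕ a , + s , + 0
segmentPoint i j k s (inj₂ (inj₂ a)) = + toℕ a , + 0 , + s

-- For positive height the three segments sit at distinct levels, so the
-- segment points are pairwise distinct.
segmentPoint-injective : ∀ i j k s′ → Injective _≡_ _≡_ (segmentPoint i j k (suc s′))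
segmentPoint-injective i j k s′ {inj₁ a} {inj₁ b} same =
  cong inj₁ (FinP.toℕ-injective (ℤP.+-injective (cong proj₁ same)))
segmentPoint-injective i j k s′ {inj₂ (inj₁ a)} {inj₂ (inj₁ b)} same =
  cong (inj₂ ∘ inj₁) (FinP.toℕ-injective (ℤP.+-injective (cong proj₁ same)))
segmentPoint-injective i j k s′ {inj₂ (inj₂ a)} {inj₂ (inj₂ b)} same =
  cong (inj₂ ∘ inj₂) (FinP.toℕ-injective (ℤP.+-injective (cong proj₁ same)))
segmentPoint-injective i j k s′ {inj₁ a}        {inj₂ (inj₁ b)} ()
segmentPoint-injective i j k s′ {inj₁ a}        {inj₂ (inj₂ b)} ()
segmentPoint-injective i j k s′ {inj₂ (inj₁ a)} {inj₁ b}        ()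
segmentPoint-injective i j k s′ {inj₂ (inj₁ a)} {inj₂ (inj₂ b)} ()
segmentPoint-injective i j k s′ {inj₂ (inj₂ a)} {inj₁ b}        ()
segmentPoint-injective i j k s′ {inj₂ (inj₂ a)} {inj₂ (inj₁ b)} ()

module Cayley (i′ j′ k′ s : ℕ) where

  open ConvexHull (cayVertices (suc i′) (suc j′) (suc k′) s) public

  origin : Hull (0ℚ , 0ℚ , 0ℚ)
  origin = vertex Fin.zero
  end-i : Hull (ℕ→ℚ (suc i′) , 0ℚ , 0ℚ)
  end-i = vertex (Fin.suc Fin.zero)
  start-j : Hull (0ℚ , ℕ→ℚ s , 0ℚ)
  start-j = vertex (Fin.suc (Fin.suc Fin.zero))
  end-j : Hull (ℕ→ℚ (suc j′) , ℕ→ℚ s , 0ℚ)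
  end-j = vertex (Fin.suc (Fin.suc (Fin.suc Fin.zero)))
  start-k : Hull (0ℚ , 0ℚ , ℕ→ℚ s)
  start-k = vertex (Fin.suc (Fin.suc (Fin.suc (Fin.suc Fin.zero))))
  end-k : Hull (ℕ→ℚ (suc k′) , 0ℚ , ℕ→ℚ s)
  end-k = vertex (Fin.suc (Fin.suc (Fin.suc (Fin.suc (Fin.suc Fin.zero)))))

  segmentPoint∈P : ∀ a → LatticeHull (segmentPoint (suc i′) (suc j′) (suc k′) s a)
  segmentPoint∈P (inj₁ a)        = along-x i′ (toℕ a) (FinP.toℕ≤pred[n] a) origin end-i
  segmentPoint∈P (inj₂ (inj₁ a)) = along-x j′ (toℕ a) (FinP.toℕ≤pred[n] a) start-j end-j
  segmentPoint∈P (inj₂ (inj₂ a)) = along-x k′ (toℕ a) (FinP.toℕ≤pred[n] a) start-k end-k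

  -- Since i, j, k ≥ 1, the points (1,0,0), (1,s,0), (1,0,s) lie in P; they
  -- are the corners needed for the triangle at height a = 1.
  corner-i : Hull (ℕ→ℚ 1 , 0ℚ , 0ℚ)
  corner-i = along-x i′ 1 (s≤s z≤n) origin end-i
  corner-j : Hull (ℕ→ℚ 1 , ℕ→ℚ s , 0ℚ)
  corner-j = along-x j′ 1 (s≤s z≤n) start-j end-j
  corner-k : Hull (ℕ→ℚ 1 , 0ℚ , ℕ→ℚ s)
  corner-k = along-x k′ 1 (s≤s z≤n) start-k end-k

three-blocks : ∀ a b c → Fin (a ℕ.+ (b ℕ.+ c)) ↔ (Fin a ⊎ (Fin b ⊎ Fin c))
three-blocks a b c = ↔-trans FinP.+↔⊎ (↔-refl ⊎-↔ FinP.+↔⊎)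

segments-bound : ∀ {N} i′ j′ k′ s′ →
  LatticeCountAtMost (InCay (suc i′) (suc j′) (suc k′) (suc s′)) N →
  suc (suc i′) + (suc (suc j′) + suc (suc k′)) ≤ N
segments-bound i′ j′ k′ s′ =
  count (segmentPoint i j k (suc s′) ∘ Injection.to enumerate)
    (Injection.injective enumerate ∘ segmentPoint-injective i j k s′)
    (segmentPoint∈P ∘ Injection.to enumerate)
  where
  open Cayley i′ j′ k′ (suc s′)
  i = suc i′
  j = suc j′
  k = suc k′
  enumerate : Fin (suc i + (suc j + suc k)) ↣ (Fin (suc i) ⊎ (Fin (suc j) ⊎ Fin (suc k)))
  enumerate = ↔⇒↣ (three-blocks (suc i) (suc j) (suc k))

tallPoints : Vec ℤ³ 18
tallPoints = triangleBoundary 0 ++ triangleBoundary 1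

tallPoints-injective : Injective _≡_ _≡_ (Vec.lookup tallPoints)
tallPoints-injective {a} {b} = from-yes (injective? (Vec.lookup tallPoints)) a b

tall-bound : ∀ {N} i′ j′ k′ m → 3 ≤ suc m →
  LatticeCountAtMost (InCay (suc i′) (suc j′) (suc k′) (suc m)) N → 18 ≤ N
tall-bound i′ j′ k′ m 3≤s =
  count (Vec.lookup tallPoints) tallPoints-injective
    (lookup⁺ (++⁺ (triangle 0 m 3≤s origin start-j start-k)
                  (triangle 1 m 3≤s corner-i corner-j corner-k)))
  where open Cayley i′ j′ k′ (suc m)

segments-sum : ∀ i j k → suc i + (suc j + suc k) ≤ 16 → i + j + k ≤ 13
segments-sum i j k bound = ℕP.+-cancelˡ-≤ 3 _ _ (subst (_≤ 16) (reassociate i j k) bound)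
  where
  reassociate : ∀ i j k → suc i + (suc j + suc k) ≡ 3 + (i + j + k)
  reassociate = solve-∀

smallest-≤4 : ∀ {i j k} → j ≤ i → k ≤ j → i + j + k ≤ 13 → k ≤ 4
smallest-≤4 {i} {j} {k} j≤i k≤j sum≤13 with k ℕ.≤? 4
... | yes k≤4 = k≤4
... | no k≰4 = ⊥-elim (from-no (15 ℕ.≤? 13) (ℕP.≤-trans 15≤3k (ℕP.≤-trans 3k≤sum sum≤13)))
  where
  5≤k : 5 ≤ k
  5≤k = ℕP.≰⇒> k≰4
  15≤3k : 15 ≤ k + k + k
  15≤3k = ℕP.+-mono-≤ (ℕP.+-mono-≤ 5≤k 5≤k) 5≤k
  3k≤sum : k + k + k ≤ i + j + k
  3k≤sum = ℕP.+-monoˡ-≤ k (ℕP.+-mono-≤ (ℕP.≤-trans k≤j j≤i) k≤j)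

lemma3 : (i j k s : ℕ) → 1 ≤ i → 1 ≤ j → 1 ≤ k → 1 ≤ s →
    LatticeCountAtMost (InCay i j k s) 16 →
    (s ≤ 2) × (i + j + k ≤ 13) × (j ≤ i → k ≤ j → k ≤ 4)
lemma3 (suc i′) (suc j′) (suc k′) (suc m) _ _ _ _ few =
  s≤2 , sum≤13 , λ j≤i k≤j → smallest-≤4 j≤i k≤j sum≤13
  where
  sum≤13 : suc i′ + suc j′ + suc k′ ≤ 13
  sum≤13 = segments-sum (suc i′) (suc j′) (suc k′) (segments-bound i′ j′ k′ m few)
  s≤2 : suc m ≤ 2
  s≤2 with suc m ℕ.≤? 2
  ... | yes s≤2 = s≤2
  ... | no s≰2 = ⊥-elim (from-no (18 ℕ.≤? 16) (tall-bound i′ j′ k′ m (ℕP.≰⇒> s≰2) few))
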